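{- Let $\mathcal{M}_2$, $\mathcal{MM}_2$ and the procedure $\psi$ be as described in the context. (1) $\psi$ is a well-defined length-preserving map from $\mathcal{M}_2$ to $\mathcal{MM}_2$: for every $s\in\mathcal{M}_2$ every required earlier step can be found, and at the end of the procedure every step of $s$ has been set to marked or unmarked. (2) Let $f:\mathcal{MM}_2\to\mathcal{M}_2$ be the map which forgets the marking. Then $f\circ\psi=\mathrm{id}_{\mathcal{M}_2}$, and hence $\mathcal{M}_2$ is in bijection with the image $\psi(\mathcal{M}_2)\subseteq\mathcal{MM}_2$.
   Context: A Motzkin path is a walk from $(0,0)$ using the steps $\nearrow=(1,1)$, $\rightarrow=(1,0)$, $\searrow=(1,-1)$, never going below the $x$-axis and ending on the $x$-axis; its length is its number of steps. $\mathcal{M}_2$ is the class of bicoloured Motzkin paths (each step coloured red or black); $\mathcal{MM}_2$ is the class of bicoloured Motzkin paths in which each step is additionally either marked or unmarked. The procedure $\psi$: given $s\in\mathcal{M}_2$, initially no step has a marking status. Call a step "free" if it has not yet been set to marked or unmarked. Read the steps of $s$ from left to right; for the current step: (1) If it is a $\nearrow$ (either colour): do nothing. (2) If it is a red $\rightarrow$: find the rightmost free step before the current step which is a red $\nearrow$ or a black $\rightarrow$. If it exists, set it to unmarked and do nothing with the current step (it remains free); otherwise set the current step to marked. (3) If it is a black $\rightarrow$: find the rightmost free step before the current step which is a black $\nearrow$ or a red $\rightarrow$. If it exists, set it to unmarked and do nothing with the current step; otherwise set the current step to marked. (4) If it is a red $\searrow$: find the rightmost free step before the current step which is a black $\nearrow$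 or a red $\rightarrow$. If it exists, set both it and the current step to unmarked. Otherwise find the rightmost free step before the current step which is a red $\nearrow$ or a black $\rightarrow$, set it to unmarked and set the current step to marked. (5) If it is a black $\searrow$: find the rightmost free step before the current step which is a red $\nearrow$ or a black $\rightarrow$. If it exists, set both it and the current step to unmarked. Otherwise find the rightmost free step before the current step which is a black $\nearrow$ or a red $\rightarrow$, set it to unmarked and set the current step to marked. The result, with the same underlying bicoloured path and the assigned markings, is $\psi(s)$. -}

module Defs where

open import Data.Nat using (ℕ; zero; suc)
open import Data.List using (List; []; _∷_; reverse)
open import Data.Product using (_×_; _,_)
open import Data.Bool using (Bool; true; false)
open import Data.Maybe using (Maybe; just; nothing)
open import Data.Empty using (⊥)
open import Data.Unit using (⊤)
open import Relation.Binary.PropositionalEquality using (_≡_)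

-- Step kinds: ↗ = up, → = flat, ↘ = down
data Dir : Set where
  up flat down : Dir

data Colour : Set where
  red black : Colour

CStep : Set
CStep = Colour × Dir

ValidFrom : ℕ → List CStep → Set
ValidFrom zero    []                   = ⊤
ValidFrom (suc h) []                   = ⊥
ValidFrom h       ((c , up)   ∷ s)     = ValidFrom (suc h) s
ValidFrom h       ((c , flat) ∷ s)     = ValidFrom h s
ValidFrom zero    ((c , down) ∷ s)     = ⊥
ValidFrom (suc h) ((c , down) ∷ s)     = ValidFrom h s

IsBicolMotzkin : List CStep → Set
IsBicolMotzkin s = ValidFrom zero s

data Status : Set where
  free marked unmarked : Status

data IsSet : Status → Set where
  isMarked   : IsSet marked
  isUnmarked : IsSet unmarked

classA : CStep → Bool
classA (red   , up)   = true
classA (black , flat) = true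
classA _              = false

classB : CStep → Bool
classB (black , up)   = true
classB (red   , flat) = true
classB _              = false

-- The state holds the already-read steps with their statuses, in REVERSE
-- order (most recent first).  findSet p st finds the rightmost (= first in
-- the reversed list) free step satisfying p and sets it to unmarked;
-- returns nothing if no such step exists.
findSet : (CStep → Bool) → List (CStep × Status) → Maybe (List (CStep × Status))
findSet p [] = nothing
findSet p ((c , free) ∷ st) with p c
... | true  = just ((c , unmarked) ∷ st)
... | false with findSet p st
...   | just st' = just ((c , free) ∷ st')
...   | nothing  = nothing
findSet p ((c , marked) ∷ st) with findSet p st
... | just st' = just ((c , marked) ∷ st')
... | nothing  = nothing
findSet p ((c , unmarked) ∷ st) with findSet p st
... | just st' = just ((c , unmarked) ∷ st')
... | nothing  = nothing

stepψ : List (CStep × Status) → CStep → Maybe (List (CStep × Status))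
stepψ st (c , up) = just (((c , up) , free) ∷ st)
stepψ st (red , flat) with findSet classA st
... | just st' = just (((red , flat) , free) ∷ st')
... | nothing  = just (((red , flat) , marked) ∷ st)
stepψ st (black , flat) with findSet classB st
... | just st' = just (((black , flat) , free) ∷ st')
... | nothing  = just (((black , flat) , marked) ∷ st)
stepψ st (red , down) with findSet classB st
... | just st' = just (((red , down) , unmarked) ∷ st')
... | nothing with findSet classA st
...   | just st' = just (((red , down) , marked) ∷ st')
...   | nothing  = nothing
stepψ st (black , down) with findSet classA st
... | just st' = just (((black , down) , unmarked) ∷ st')
... | nothing with findSet classB st
...   | just st' = just (((black , down) , marked) ∷ st')
...   | nothing  = nothing

runψ : List (CStep × Status) → List CStep → Maybe (List (CStep × Status))
runψ st []      = just st
runψ st (c ∷ s) with stepψ st c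
... | just st' = runψ st' s
... | nothing  = nothing

ψ : List CStep → Maybe (List (CStep × Status))
ψ s with runψ [] s
... | just st = just (reverse st)
... | nothing = nothing

-- While ψ reads a Motzkin path, the free steps are exactly as many as the current
-- height, and none of them is a ↘: a ↗ adds a free step, a → either unmarks one
-- free step and stays free itself or is marked, and a ↘ unmarks exactly one free
-- step.  Every free step that is not a ↘ lies in one of the two searched classes
-- (red ↗ or black →, black ↗ or red →), so a ↘, read at positive height, always
-- finds its partner; at the end the height is 0, so no step is left free.  Since
-- every move only prepends the current step and updates statuses, forgetting the
-- marking gives back the path, which also makes ψ injective.
module Submission where

open import Defs
open import Data.Bool using (Bool; true; false)
open import Data.List using (List; []; _∷_; map; length; reverse; _ʳ++_)
open import Data.List.Properties using (length-map; reverse-map; reverse-involutive)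
open import Data.List.Relation.Unary.All using (All; []; _∷_)
open import Data.List.Relation.Binary.Permutation.Propositional using (↭-sym)
open import Data.List.Relation.Binary.Permutation.Propositional.Properties
  using (All-resp-↭; ↭-reverse)
open import Data.Maybe using (just; nothing)
open import Data.Nat using (ℕ; zero; suc)
open import Data.Nat.Properties using (suc-injective)
open import Data.Product using (Σ; ∃; _×_; _,_; proj₁; proj₂)
open import Data.Sum using (_⊎_; inj₁; inj₂)
open import Data.Unit using (⊤; tt)
open import Relation.Binary.PropositionalEquality using (_≡_; _≢_; refl; sym; trans; cong)
open import Relation.Nullary using (contradiction)

State : Set
State = List (CStep × Status)

steps : State → List CStep
steps = map proj₁

freeCount : State → ℕ
freeCount []                    = 0
freeCount ((_ , free)     ∷ st) = suc (freeCount st)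
freeCount ((_ , marked)   ∷ st) = freeCount st
freeCount ((_ , unmarked) ∷ st) = freeCount st

NotFreeDown : CStep × Status → Set
NotFreeDown (c , free)     = proj₂ c ≢ down
NotFreeDown (_ , marked)   = ⊤
NotFreeDown (_ , unmarked) = ⊤

data _⇝_ : State → State → Set where
  here  : ∀ {c st} → ((c , free) ∷ st) ⇝ ((c , unmarked) ∷ st)
  there : ∀ {x st st'} → st ⇝ st' → (x ∷ st) ⇝ (x ∷ st')

⇝-freeCount : ∀ {st st'} → st ⇝ st' → freeCount st ≡ suc (freeCount st')
⇝-freeCount here                     = refl
⇝-freeCount (there {_ , free} u)     = cong suc (⇝-freeCount u)
⇝-freeCount (there {_ , marked} u)   = ⇝-freeCount u
⇝-freeCount (there {_ , unmarked} u) = ⇝-freeCount u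

⇝-steps : ∀ {st st'} → st ⇝ st' → steps st' ≡ steps st
⇝-steps here      = refl
⇝-steps (there u) = cong (_ ∷_) (⇝-steps u)

⇝-notFreeDown : ∀ {st st'} → st ⇝ st' → All NotFreeDown st → All NotFreeDown st'
⇝-notFreeDown here      (_ ∷ g) = tt ∷ g
⇝-notFreeDown (there u) (n ∷ g) = n ∷ ⇝-notFreeDown u g

findSet-⇝ : ∀ p st {st'} → findSet p st ≡ just st' → st ⇝ st'
findSet-⇝ p ((c , free) ∷ st) e with p c
... | true  with refl ← e = here
... | false with findSet p st in e'
...   | just _ with refl ← e = there (findSet-⇝ p st e')
findSet-⇝ p ((c , marked) ∷ st) e with findSet p st in e'
... | just _ with refl ← e = there (findSet-⇝ p st e')
findSet-⇝ p ((c , unmarked) ∷ st) e with findSet p st in e'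
... | just _ with refl ← e = there (findSet-⇝ p st e')

FreeFails : (CStep → Bool) → CStep × Status → Set
FreeFails p (c , σ) = σ ≡ free → p c ≡ false

findSet-nothing : ∀ p st → findSet p st ≡ nothing → All (FreeFails p) st
findSet-nothing p [] _ = []
findSet-nothing p ((c , free) ∷ st) e with p c in pc
... | false with findSet p st in e'
...   | nothing = (λ _ → pc) ∷ findSet-nothing p st e'
findSet-nothing p ((c , marked) ∷ st) e with findSet p st in e'
... | nothing = (λ ()) ∷ findSet-nothing p st e'
findSet-nothing p ((c , unmarked) ∷ st) e with findSet p st in e'
... | nothing = (λ ()) ∷ findSet-nothing p st e'

classA-or-classB : ∀ c → proj₂ c ≢ down → classA c ≡ true ⊎ classB c ≡ true
classA-or-classB (red   , up)   _  = inj₁ refl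
classA-or-classB (black , up)   _  = inj₂ refl
classA-or-classB (red   , flat) _  = inj₂ refl
classA-or-classB (black , flat) _  = inj₁ refl
classA-or-classB (_     , down) nd = contradiction refl nd

freeCount≡0 : ∀ st → All NotFreeDown st → All (FreeFails classA) st → All (FreeFails classB) st →
              freeCount st ≡ 0
freeCount≡0 [] _ _ _ = refl
freeCount≡0 ((c , free) ∷ st) (nd ∷ _) (fa ∷ _) (fb ∷ _) with classA-or-classB c nd
... | inj₁ a = contradiction (trans (sym a) (fa refl)) λ ()
... | inj₂ b = contradiction (trans (sym b) (fb refl)) λ ()
freeCount≡0 ((c , marked)   ∷ st) (_ ∷ g) (_ ∷ fa) (_ ∷ fb) = freeCount≡0 st g fa fb
freeCount≡0 ((c , unmarked) ∷ st) (_ ∷ g) (_ ∷ fa) (_ ∷ fb) = freeCount≡0 st g fa fb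

Invariant : ℕ → State → Set
Invariant h st = freeCount st ≡ h × All NotFreeDown st

data Move : ℕ → Dir → ℕ → Set where
  rise  : ∀ {h} → Move h up (suc h)
  level : ∀ {h} → Move h flat h
  fall  : ∀ {h} → Move (suc h) down h

validFrom-uncons : ∀ h c d s → ValidFrom h ((c , d) ∷ s) → ∃ λ h' → Move h d h' × ValidFrom h' s
validFrom-uncons zero    _ up   _ v = 1 , rise , v
validFrom-uncons (suc h) _ up   _ v = suc (suc h) , rise , v
validFrom-uncons zero    _ flat _ v = zero , level , v
validFrom-uncons (suc h) _ flat _ v = suc h , level , v
validFrom-uncons (suc h) _ down _ v = h , fall , v

searches-fail⇒height≡0 : ∀ {h} st → Invariant h st →
  findSet classA st ≡ nothing → findSet classB st ≡ nothing → h ≡ 0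
searches-fail⇒height≡0 st (fc , g) eA eB =
  trans (sym fc) (freeCount≡0 st g (findSet-nothing classA st eA) (findSet-nothing classB st eB))

Extends : ℕ → State → CStep → State → Set
Extends h st x st' = Invariant h st' × steps st' ≡ x ∷ steps st

push-free : ∀ {h st} x → proj₂ x ≢ down → Invariant h st → Extends (suc h) st x ((x , free) ∷ st)
push-free x nd (fc , g) = (cong suc fc , nd ∷ g) , refl

push-set : ∀ {h st σ} x → IsSet σ → Invariant h st → Invariant h ((x , σ) ∷ st)
push-set x isMarked   (fc , g) = fc , tt ∷ g
push-set x isUnmarked (fc , g) = fc , tt ∷ g

⇝-invariant : ∀ {h st st'} → st ⇝ st' → Invariant (suc h) st → Invariant h st'
⇝-invariant u (fc , g) = suc-injective (trans (sym (⇝-freeCount u)) fc) , ⇝-notFreeDown u g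

unmark-push-free : ∀ {h st st'} x → proj₂ x ≢ down → st ⇝ st' → Invariant h st →
                   Extends h st x ((x , free) ∷ st')
unmark-push-free x nd u (fc , g) =
  (trans (sym (⇝-freeCount u)) fc , nd ∷ ⇝-notFreeDown u g) , cong (x ∷_) (⇝-steps u)

unmark-push-set : ∀ {h st st' σ} x → IsSet σ → st ⇝ st' → Invariant (suc h) st →
                  Extends h st x ((x , σ) ∷ st')
unmark-push-set x σ u inv = push-set x σ (⇝-invariant u inv) , cong (x ∷_) (⇝-steps u)

Reads : ℕ → State → CStep → Set
Reads h st x = ∃ λ st' → stepψ st x ≡ just st' × Extends h st x st'

reads : ∀ {h h'} st c d → Move h d h' → Invariant h st → Reads h' st (c , d)
reads st c up rise inv = _ , refl , push-free (c , up) (λ ()) inv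
reads st red flat level inv with findSet classA st in e
... | just _  = _ , refl , unmark-push-free (red , flat) (λ ()) (findSet-⇝ classA st e) inv
... | nothing = _ , refl , (push-set (red , flat) isMarked inv , refl)
reads st black flat level inv with findSet classB st in e
... | just _  = _ , refl , unmark-push-free (black , flat) (λ ()) (findSet-⇝ classB st e) inv
... | nothing = _ , refl , (push-set (black , flat) isMarked inv , refl)
reads st red down fall inv with findSet classB st in eB
... | just _  = _ , refl , unmark-push-set (red , down) isUnmarked (findSet-⇝ classB st eB) inv
... | nothing with findSet classA st in eA
...   | just _  = _ , refl , unmark-push-set (red , down) isMarked (findSet-⇝ classA st eA) inv
...   | nothing = contradiction (searches-fail⇒height≡0 st inv eA eB) λ ()
reads st black down fall inv with findSet classA st in eA
... | just _  = _ , refl , unmark-push-set (black , down) isUnmarked (findSet-⇝ classA st eA) inv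
... | nothing with findSet classB st in eB
...   | just _  = _ , refl , unmark-push-set (black , down) isMarked (findSet-⇝ classB st eB) inv
...   | nothing = contradiction (searches-fail⇒height≡0 st inv eA eB) λ ()

runψ-invariant : ∀ h st s → ValidFrom h s → Invariant h st →
  ∃ λ st' → runψ st s ≡ just st' × Invariant 0 st' × steps st' ≡ s ʳ++ steps st
runψ-invariant zero    st []      _ inv = st , refl , inv , refl
runψ-invariant h st ((c , d) ∷ s) v inv with validFrom-uncons h c d s v
... | h' , m , v' with stepψ st (c , d) | reads st c d m inv
...   | just st₁ | (_ , refl , inv₁ , eq₁) with runψ-invariant h' st₁ s v' inv₁
...     | st' , e , inv' , eq rewrite eq₁ = st' , e , inv' , eq

freeCount≡0⇒allSet : ∀ st → freeCount st ≡ 0 → All (λ p → IsSet (proj₂ p)) st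
freeCount≡0⇒allSet []                   _ = []
freeCount≡0⇒allSet ((_ , marked)   ∷ st) e = isMarked ∷ freeCount≡0⇒allSet st e
freeCount≡0⇒allSet ((_ , unmarked) ∷ st) e = isUnmarked ∷ freeCount≡0⇒allSet st e

ψ-runψ : ∀ s {st} → runψ [] s ≡ just st → ψ s ≡ just (reverse st)
ψ-runψ s e rewrite e = refl

ψ-total : ∀ s → IsBicolMotzkin s →
  Σ State λ r → ψ s ≡ just r × All (λ p → IsSet (proj₂ p)) r × map proj₁ r ≡ s
ψ-total s v with runψ-invariant 0 [] s v (refl , [])
... | st , e , (fc , _) , steps≡ =
  reverse st , ψ-runψ s e ,
  All-resp-↭ (↭-sym (↭-reverse st)) (freeCount≡0⇒allSet st fc) ,
  trans (reverse-map proj₁ st) (trans (cong reverse steps≡) (reverse-involutive s))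

ψ-injective : ∀ s t {r} → IsBicolMotzkin s → IsBicolMotzkin t → ψ s ≡ just r → ψ t ≡ just r → s ≡ t
ψ-injective s t vs vt es et with ψ-total s vs | ψ-total t vt
... | _ , es' , _ , forget-s | _ , et' , _ , forget-t
  with refl ← trans (sym es) es' | refl ← trans (sym et) et' = trans (sym forget-s) forget-t

mainTheorem6 :
    ((s : List CStep) → IsBicolMotzkin s →
      Σ (List (CStep × Status)) λ r →
        (ψ s ≡ just r) × (All (λ p → IsSet (proj₂ p)) r)
          × (length r ≡ length s) × (map proj₁ r ≡ s))
    × ((s t : List CStep) (r : List (CStep × Status)) →
        IsBicolMotzkin s → IsBicolMotzkin t →
        ψ s ≡ just r → ψ t ≡ just r → s ≡ t)
mainTheorem6 =
  (λ s v → let (r , e , set , forget) = ψ-total s v in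
             r , e , set , trans (sym (length-map proj₁ r)) (cong length forget) , forget)
  , λ s t _ → ψ-injective s t
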